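{- For an integer $n\ge 2$ let $\mathtt{A}=[a_{ij}]$ be the $n\times n$ matrix with $a_{ij}=1$ if $j=i+1$ or $i+j=n+1$, and $a_{ij}=0$ otherwise ($i,j\in\{1,\dots,n\}$). Let $P_n(\lambda)=\det(\lambda\mathtt{I}-\mathtt{A})=(-1)^n|\mathtt{A}-\lambda\mathtt{I}|$. Then $$P_n(\lambda)=\begin{cases}\displaystyle\sum_{k=1}^{[\frac{n+2}{4}]+1}(-1)^{k-1}\binom{\frac n2-k+2}{k-1}\lambda^{n-2k+2}, & n \text{ even},\\[3ex] \displaystyle\sum_{k=1}^{[\frac{n+2}{4}]+2}(-1)^{k-1}\left(\binom{\frac{n+3}{2}-k}{k-1}+\binom{\frac{n+3}{2}-k}{k-2}\lambda\right)\lambda^{n-2k+2}, & n \text{ odd}.\end{cases}$$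
   Context: $[x]$ denotes the integer part of $x$. Binomial coefficients follow the convention $\binom{a}{b}=0$ when $b<0$ or $b>a$ (for nonnegative integers $a$). $\mathtt{I}$ is the identity matrix. -}

module Defs where

open import Level using (Level)
open import Algebra.Bundles using (CommutativeRing; Semiring)
import Algebra.Definitions.RawSemiring as RS
open import Data.Nat as ℕ using (ℕ; zero; suc; _∸_)
open import Data.Nat.Combinatorics using (_C_)
open import Data.Integer as ℤ using (ℤ; +_; -[1+_])
open import Data.Fin using (Fin; toℕ; punchIn)
import Data.Fin as Fin
open import Data.Sum using (_⊎_)
open import Relation.Binary.PropositionalEquality using (_≡_)
open import Relation.Nullary.Decidable using (Dec; yes; no; _⊎-dec_)

-- Binomial coefficient with integer lower index: (a choose b) = 0 when b < 0
-- (and, via the library's _C_, also 0 when b > a).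
binomℤ : ℕ → ℤ → ℕ
binomℤ a (+ b)     = a C b
binomℤ a -[1+ _ ]  = 0

module _ {c ℓ : Level} (R : CommutativeRing c ℓ) where
  open CommutativeRing R
  open RS (Semiring.rawSemiring semiring) using (_^_; _×_)

  ΣFin : (n : ℕ) → (Fin n → Carrier) → Carrier
  ΣFin zero    f = 0#
  ΣFin (suc n) f = f Fin.zero + ΣFin n (λ j → f (Fin.suc j))

  Σ1 : ℕ → (ℕ → Carrier) → Carrier
  Σ1 zero    f = 0#
  Σ1 (suc m) f = Σ1 m f + f (suc m)

  det : (n : ℕ) → (Fin n → Fin n → Carrier) → Carrier
  det zero    M = 1#
  det (suc n) M =
    ΣFin (suc n) λ j →
      ((- 1#) ^ toℕ j) * (M Fin.zero j * det n (λ r s → M (Fin.suc r) (punchIn j s)))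

  -- the matrix A (0-based indices i, j correspond to 1-based i+1, j+1):
  -- a_ij = 1 iff j = i+1 or i+j = n+1 (1-based)
  Amat : (n : ℕ) → Fin n → Fin n → Carrier
  Amat n i j with (toℕ j ℕ.≟ suc (toℕ i)) ⊎-dec (suc (toℕ i) ℕ.+ suc (toℕ j) ℕ.≟ suc n)
  ... | yes _ = 1#
  ... | no  _ = 0#

  identity : (n : ℕ) → Fin n → Fin n → Carrier
  identity n i j with i Fin.≟ j
  ... | yes _ = 1#
  ... | no  _ = 0#

  charPoly : ℕ → Carrier → Carrier
  charPoly n x = det n (λ i j → (x * identity n i j) - Amat n i j)

  rhsEven : ℕ → Carrier → Carrier
  rhsEven n x = Σ1 (suc ((n ℕ.+ 2) ℕ./ 4)) λ k →
    ((- 1#) ^ (k ∸ 1)) * ((binomℤ ((ℕ.⌊ n /2⌋ ℕ.+ 2) ∸ k) (+ k ℤ.- + 1) × 1#) * (x ^ ((n ℕ.+ 2) ∸ (2 ℕ.* k))))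

  rhsOdd : ℕ → Carrier → Carrier
  rhsOdd n x = Σ1 (suc (suc ((n ℕ.+ 2) ℕ./ 4))) λ k →
    ((- 1#) ^ (k ∸ 1)) *
      ( ((binomℤ (ℕ.⌊ n ℕ.+ 3 /2⌋ ∸ k) (+ k ℤ.- + 1) × 1#) * (x ^ ((n ℕ.+ 2) ∸ (2 ℕ.* k))))
      + ((binomℤ (ℕ.⌊ n ℕ.+ 3 /2⌋ ∸ k) (+ k ℤ.- + 2) × 1#) * (x ^ ((n ℕ.+ 3) ∸ (2 ℕ.* k)))))

-- Expanding det(xI − A_n) along its first column, and the minor ψ_p of xI − A_{p+1} without its last
-- row and first column along its first row, gives χ_{k+2} = x²χ_k + (−1)^k ψ_{k+1} and
-- ψ_{k+2} = ψ_k + (−1)^k χ_{k+1}; eliminating ψ yields χ_{k+4} = x²(χ_{k+2} − χ_k).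
-- By Pascal's rule the even closed form E_m (closedForm m, n = 2m) satisfies the same recurrence in m, and it
-- agrees with χ_{2m} for m = 0, 1. The odd closed form is x E_{m+1} − x² E_m (with n = 2m + 3), and
-- χ_{2m+3} = x χ_{2m+2} − x² χ_{2m} since both sides satisfy the recurrence and agree for m = 0, 1.
module Submission where

open import Defs
open import Level using (Level; _⊔_)
open import Algebra.Bundles using (CommutativeRing; Semiring)
import Algebra.Definitions.RawSemiring as RawSemiring
open import Data.Nat as ℕ using (ℕ; zero; suc; _∸_; _≤_; _<_; _≥_; z≤n; s≤s; _/_; _%_; ⌊_/2⌋)
open import Data.Nat.DivMod using (m≡m%n+[m/n]*n; m%n<n)
open import Data.Nat.Combinatorics using (_C_; nCk+nC[k+1]≡[n+1]C[k+1]; k>n⇒nCk≡0)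
open import Data.Nat.Divisibility using (_∣_; divides; ∣1⇒≡1; ∣m+n∣m⇒∣n)
open import Data.Fin as Fin using (Fin; toℕ; punchIn; inject₁; fromℕ)
import Data.Fin.Properties as Fin
open import Data.Vec.Functional using (transpose)
open import Data.Integer as ℤ using (ℤ; +_; -[1+_])
import Data.Integer.Properties as ℤ
open import Data.Sign as Sign using (Sign)
open import Data.Maybe using (Maybe; just; nothing)
open import Relation.Nullary using (¬_; Dec; yes; no; contradiction)
open import Relation.Nullary.Decidable using (_⊎-dec_)
open import Data.Sum using (_⊎_; inj₁; inj₂)
open import Data.Product using (Σ; _,_)
import Data.Nat.Properties as ℕ
open import Relation.Binary.PropositionalEquality as ≡ using (_≡_; _≢_)
open import Function using (_∘_)
import Algebra.Solver.Ring.AlmostCommutativeRing as AlmostCommutativeRing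

double : ℕ → ℕ
double zero    = zero
double (suc n) = suc (suc (double n))

double≡+ : ∀ k → double k ≡ k ℕ.+ k
double≡+ zero    = ≡.refl
double≡+ (suc k) = ≡.cong suc (≡.trans (≡.cong suc (double≡+ k)) (≡.sym (ℕ.+-suc k k)))

2*≡double : ∀ k → 2 ℕ.* k ≡ double k
2*≡double k = ≡.trans (≡.cong (k ℕ.+_) (ℕ.+-identityʳ k)) (≡.sym (double≡+ k))

double-∸ : ∀ a b → double a ∸ double b ≡ double (a ∸ b)
double-∸ a       zero    = ≡.refl
double-∸ zero    (suc b) = ≡.refl
double-∸ (suc a) (suc b) = double-∸ a b

suc-double-∸ : ∀ a b → b ≤ a → suc (double a) ∸ double b ≡ suc (double (a ∸ b))
suc-double-∸ a       zero    _         = ≡.refl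
suc-double-∸ (suc a) (suc b) (s≤s b≤a) = suc-double-∸ a b b≤a

⌊double/2⌋≡ : ∀ m → ⌊ double m /2⌋ ≡ m
⌊double/2⌋≡ zero    = ≡.refl
⌊double/2⌋≡ (suc m) = ≡.cong suc (⌊double/2⌋≡ m)

double-cancel-< : ∀ a b → double a < double b → a < b
double-cancel-< zero    (suc b) _                 = s≤s z≤n
double-cancel-< (suc a) (suc b) (s≤s (s≤s 2a<2b)) = s≤s (double-cancel-< a b 2a<2b)

*4≡double-+ : ∀ j → j ℕ.* 4 ≡ double (j ℕ.+ j)
*4≡double-+ zero    = ≡.refl
*4≡double-+ (suc j) = ≡.cong (suc ∘ suc) (≡.trans (≡.cong (suc ∘ suc) (*4≡double-+ j)) (≡.cong double (≡.sym (ℕ.+-suc j j))))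

/4<⇒<*4 : ∀ a j → a / 4 < j → a < j ℕ.* 4
/4<⇒<*4 a j a/4<j = begin-strict
  a                      ≡⟨ m≡m%n+[m/n]*n a 4 ⟩
  a % 4 ℕ.+ a / 4 ℕ.* 4  <⟨ ℕ.+-monoˡ-< (a / 4 ℕ.* 4) (m%n<n a 4) ⟩
  suc (a / 4) ℕ.* 4      ≤⟨ ℕ.*-monoˡ-≤ 4 a/4<j ⟩
  j ℕ.* 4                ∎
  where open ℕ.≤-Reasoning

-- Beyond the paper's summation limits all summands vanish because of this bound.
quarter-bound : ∀ m a j → double (suc m) ≤ a → a / 4 < j → suc m < j ℕ.+ j
quarter-bound m a j 2[m+1]≤a a/4<j = double-cancel-< (suc m) (j ℕ.+ j)
  (≡.subst (double (suc m) <_) (*4≡double-+ j) (ℕ.≤-<-trans 2[m+1]≤a (/4<⇒<*4 a j a/4<j)))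

1+m≤n⇒1+m<n+n : ∀ {m n} → suc m ≤ n → suc m < n ℕ.+ n
1+m≤n⇒1+m<n+n {n = suc n} (s≤s m≤n) = s≤s (ℕ.≤-trans (s≤s m≤n) (ℕ.m≤n+m (suc n) n))

even-or-odd : ∀ n → Σ ℕ (λ m → n ≡ double m) ⊎ Σ ℕ (λ m → n ≡ suc (double m))
even-or-odd zero = inj₁ (0 , ≡.refl)
even-or-odd (suc n) with even-or-odd n
... | inj₁ (m , n≡2m)   = inj₂ (m , ≡.cong suc n≡2m)
... | inj₂ (m , n≡2m+1) = inj₁ (suc m , ≡.cong suc n≡2m+1)

2∣double : ∀ m → 2 ∣ double m
2∣double m = divides m (≡.trans (≡.sym (2*≡double m)) (ℕ.*-comm 2 m))

2∤suc-double : ∀ m → ¬ 2 ∣ suc (double m)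
2∤suc-double m 2∣2m+1 with ∣1⇒≡1 (∣m+n∣m⇒∣n (≡.subst (2 ∣_) (ℕ.+-comm 1 (double m)) 2∣2m+1) (2∣double m))
... | ()

module IntegerCoefficients {c ℓ : Level} (R : CommutativeRing c ℓ) where
  open CommutativeRing R
  open import Algebra.Properties.Ring ring
    using (-‿involutive; -0#≈0#; -‿distribˡ-*; -‿distribʳ-*; -‿+-comm; x≈z//y)
  open import Algebra.Properties.Semiring.Mult.TCOptimised semiring
    using (_×_; 1+×; ×-homo-+; ×1-homo-*)
  open import Relation.Binary.Reasoning.Setoid setoid

  -- The ring solver over an arbitrary commutative ring needs the integers as coefficients. With the
  -- optimised multiplication ⟦ + 1 ⟧ reduces to 1#, so solved equations match goals containing 1#.
  ⟦_⟧ : ℤ → Carrier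
  ⟦ + n ⟧      = n × 1#
  ⟦ -[1+ n ] ⟧ = - (suc n × 1#)

  ⟦⊖⟧+⟦n⟧≈⟦m⟧ : ∀ m n → ⟦ m ℤ.⊖ n ⟧ + n × 1# ≈ m × 1#
  ⟦⊖⟧+⟦n⟧≈⟦m⟧ m       zero    = +-identityʳ _
  ⟦⊖⟧+⟦n⟧≈⟦m⟧ zero    (suc n) = -‿inverseˡ _
  ⟦⊖⟧+⟦n⟧≈⟦m⟧ (suc m) (suc n) = begin
    ⟦ suc m ℤ.⊖ suc n ⟧ + suc n × 1#  ≡⟨ ≡.cong (λ i → ⟦ i ⟧ + suc n × 1#) (ℤ.[1+m]⊖[1+n]≡m⊖n m n) ⟩
    ⟦ m ℤ.⊖ n ⟧ + suc n × 1#          ≈⟨ +-congˡ (1+× n 1#) ⟩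
    ⟦ m ℤ.⊖ n ⟧ + (1# + n × 1#)       ≈⟨ +-congˡ (+-comm _ _) ⟩
    ⟦ m ℤ.⊖ n ⟧ + (n × 1# + 1#)       ≈⟨ +-assoc _ _ _ ⟨
    ⟦ m ℤ.⊖ n ⟧ + n × 1# + 1#         ≈⟨ +-congʳ (⟦⊖⟧+⟦n⟧≈⟦m⟧ m n) ⟩
    m × 1# + 1#                        ≈⟨ +-comm _ _ ⟩
    1# + m × 1#                        ≈⟨ 1+× m 1# ⟨
    suc m × 1#                         ∎

  ⟦⊖⟧ : ∀ m n → ⟦ m ℤ.⊖ n ⟧ ≈ m × 1# - n × 1#
  ⟦⊖⟧ m n = x≈z//y _ _ _ (⟦⊖⟧+⟦n⟧≈⟦m⟧ m n)

  ⟦-⟧ : ∀ i → ⟦ ℤ.- i ⟧ ≈ - ⟦ i ⟧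
  ⟦-⟧ (+ zero)   = sym -0#≈0#
  ⟦-⟧ (+ suc n)  = refl
  ⟦-⟧ -[1+ n ]   = sym (-‿involutive _)

  ⟦+⟧ : ∀ i j → ⟦ i ℤ.+ j ⟧ ≈ ⟦ i ⟧ + ⟦ j ⟧
  ⟦+⟧ (+ m)      (+ n)      = ×-homo-+ 1# m n
  ⟦+⟧ (+ m)      -[1+ n ]   = ⟦⊖⟧ m (suc n)
  ⟦+⟧ -[1+ m ]   (+ n)      = trans (⟦⊖⟧ n (suc m)) (+-comm _ _)
  ⟦+⟧ -[1+ m ]   -[1+ n ]   = begin
    - (suc (suc m ℕ.+ n) × 1#)         ≈⟨ -‿cong (1+× (suc m ℕ.+ n) 1#) ⟩
    - (1# + (suc m ℕ.+ n) × 1#)        ≈⟨ -‿cong (+-congˡ (×-homo-+ 1# (suc m) n)) ⟩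
    - (1# + (suc m × 1# + n × 1#))     ≈⟨ -‿cong (+-congˡ (+-comm _ _)) ⟩
    - (1# + (n × 1# + suc m × 1#))     ≈⟨ -‿cong (+-assoc _ _ _) ⟨
    - (1# + n × 1# + suc m × 1#)       ≈⟨ -‿cong (+-congʳ (1+× n 1#)) ⟨
    - (suc n × 1# + suc m × 1#)        ≈⟨ -‿cong (+-comm _ _) ⟩
    - (suc m × 1# + suc n × 1#)        ≈⟨ -‿+-comm _ _ ⟨
    - (suc m × 1#) + - (suc n × 1#)    ∎

  signed : Sign → Carrier → Carrier
  signed Sign.+ y = y
  signed Sign.- y = - y

  ⟦◃⟧ : ∀ s n → ⟦ s ℤ.◃ n ⟧ ≈ signed s (n × 1#)
  ⟦◃⟧ Sign.+ zero    = refl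
  ⟦◃⟧ Sign.- zero    = sym -0#≈0#
  ⟦◃⟧ Sign.+ (suc n) = refl
  ⟦◃⟧ Sign.- (suc n) = refl

  ⟦⟧≈signed : ∀ i → ⟦ i ⟧ ≈ signed (ℤ.sign i) (ℤ.∣ i ∣ × 1#)
  ⟦⟧≈signed (+ zero)  = refl
  ⟦⟧≈signed (+ suc n) = refl
  ⟦⟧≈signed -[1+ n ]  = refl

  signed-* : ∀ s t y z → signed (s Sign.* t) (y * z) ≈ signed s y * signed t z
  signed-* Sign.+ Sign.+ y z = refl
  signed-* Sign.+ Sign.- y z = -‿distribʳ-* y z
  signed-* Sign.- Sign.+ y z = -‿distribˡ-* y z
  signed-* Sign.- Sign.- y z = begin
    y * z          ≈⟨ -‿involutive _ ⟨
    - - (y * z)    ≈⟨ -‿cong (-‿distribʳ-* y z) ⟩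
    - (y * - z)    ≈⟨ -‿distribˡ-* y (- z) ⟩
    - y * - z      ∎

  ⟦*⟧ : ∀ i j → ⟦ i ℤ.* j ⟧ ≈ ⟦ i ⟧ * ⟦ j ⟧
  ⟦*⟧ i j = begin
    ⟦ s ℤ.◃ ℤ.∣ i ∣ ℕ.* ℤ.∣ j ∣ ⟧                              ≈⟨ ⟦◃⟧ s (ℤ.∣ i ∣ ℕ.* ℤ.∣ j ∣) ⟩
    signed s ((ℤ.∣ i ∣ ℕ.* ℤ.∣ j ∣) × 1#)                         ≈⟨ signed-cong s (×1-homo-* ℤ.∣ i ∣ ℤ.∣ j ∣) ⟩
    signed s (ℤ.∣ i ∣ × 1# * ℤ.∣ j ∣ × 1#)                        ≈⟨ signed-* (ℤ.sign i) (ℤ.sign j) _ _ ⟩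
    signed (ℤ.sign i) (ℤ.∣ i ∣ × 1#) * signed (ℤ.sign j) (ℤ.∣ j ∣ × 1#) ≈⟨ *-cong (⟦⟧≈signed i) (⟦⟧≈signed j) ⟨
    ⟦ i ⟧ * ⟦ j ⟧                                                 ∎
    where
    s = ℤ.sign i Sign.* ℤ.sign j
    signed-cong : ∀ s {y z} → y ≈ z → signed s y ≈ signed s z
    signed-cong Sign.+ y≈z = y≈z
    signed-cong Sign.- y≈z = -‿cong y≈z

  ℤ⟶R : ℤ.+-*-rawRing AlmostCommutativeRing.-Raw-AlmostCommutative⟶ AlmostCommutativeRing.fromCommutativeRing R
  ℤ⟶R = record
    { ⟦_⟧    = ⟦_⟧
    ; +-homo = ⟦+⟧
    ; *-homo = ⟦*⟧
    ; -‿homo = ⟦-⟧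
    ; 0-homo = refl
    ; 1-homo = refl
    }

  ⟦⟧-≟ : ∀ i j → Maybe (⟦ i ⟧ ≈ ⟦ j ⟧)
  ⟦⟧-≟ i j with i ℤ.≟ j
  ... | yes ≡.refl = just refl
  ... | no _       = nothing

  open import Algebra.Solver.Ring ℤ.+-*-rawRing (AlmostCommutativeRing.fromCommutativeRing R) ℤ⟶R ⟦⟧-≟ public
    using (solve; _:=_; _:+_; _:-_; _:*_; :-_; con)

punchIn-fromℕ : ∀ {n} (s : Fin n) → punchIn (fromℕ n) s ≡ inject₁ s
punchIn-fromℕ Fin.zero    = ≡.refl
punchIn-fromℕ (Fin.suc s) = ≡.cong Fin.suc (punchIn-fromℕ s)

punchIn-inject₁-fromℕ : ∀ {n} (k : Fin (suc n)) → punchIn (inject₁ k) (fromℕ n) ≡ fromℕ (suc n)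
punchIn-inject₁-fromℕ         Fin.zero    = ≡.refl
punchIn-inject₁-fromℕ {suc n} (Fin.suc k) = ≡.cong Fin.suc (punchIn-inject₁-fromℕ k)

punchIn-inject₁-inject₁ : ∀ {n} (k : Fin (suc n)) (s : Fin n) → punchIn (inject₁ k) (inject₁ s) ≡ inject₁ (punchIn k s)
punchIn-inject₁-inject₁ Fin.zero    s           = ≡.refl
punchIn-inject₁-inject₁ (Fin.suc k) Fin.zero    = ≡.refl
punchIn-inject₁-inject₁ (Fin.suc k) (Fin.suc s) = ≡.cong Fin.suc (punchIn-inject₁-inject₁ k s)

module Determinant {c ℓ : Level} (R : CommutativeRing c ℓ) where
  open CommutativeRing R
  open RawSemiring (Semiring.rawSemiring semiring) using (_^_)
  open import Algebra.Properties.Semiring.Sum semiring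
    using (sum; sum-cong-≋; sum-replicate-zero; sum-init-last; ∑-comm; *-distribˡ-sum; *-distribʳ-sum)
  open import Relation.Binary.Reasoning.Setoid setoid
  open IntegerCoefficients R

  Matrix : ℕ → Set c
  Matrix n = Fin n → Fin n → Carrier

  sign : ∀ {n} → Fin n → Carrier
  sign j = (- 1#) ^ toℕ j

  minor : ∀ {n} → Fin (suc n) → Matrix (suc n) → Matrix n
  minor j M r s = M (Fin.suc r) (punchIn j s)

  ΣFin≡sum : ∀ n (f : Fin n → Carrier) → ΣFin R n f ≡ sum f
  ΣFin≡sum zero    f = ≡.refl
  ΣFin≡sum (suc n) f = ≡.cong (_+_ (f Fin.zero)) (ΣFin≡sum n (λ j → f (Fin.suc j)))

  laplaceTerm : ∀ {n} → Matrix (suc n) → Fin (suc n) → Carrier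
  laplaceTerm {n} M j = sign j * (M Fin.zero j * det R n (minor j M))

  det-expand : ∀ n (M : Matrix (suc n)) → det R (suc n) M ≡ sum (laplaceTerm M)
  det-expand n M = ΣFin≡sum (suc n) (laplaceTerm M)

  sum-zero : ∀ {n} (f : Fin n → Carrier) → (∀ j → f j ≈ 0#) → sum f ≈ 0#
  sum-zero {n} f f≈0 = trans (sum-cong-≋ f≈0) (sum-replicate-zero n)

  sum-first-last : ∀ {n} (f : Fin (suc (suc n)) → Carrier) → (∀ j → f (Fin.suc (inject₁ j)) ≈ 0#) →
    sum f ≈ f Fin.zero + f (fromℕ (suc n))
  sum-first-last f middle≈0 = +-congˡ (begin
    sum (λ j → f (Fin.suc j))                                        ≈⟨ sum-init-last (λ j → f (Fin.suc j)) ⟩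
    sum (λ j → f (Fin.suc (inject₁ j))) + f (fromℕ (suc _))          ≈⟨ +-congʳ (sum-zero (λ j → f (Fin.suc (inject₁ j))) middle≈0) ⟩
    0# + f (fromℕ (suc _))                                           ≈⟨ +-identityˡ _ ⟩
    f (fromℕ (suc _))                                                ∎)

  laplaceTerm-zero : ∀ {n} (M : Matrix (suc n)) j → M Fin.zero j ≈ 0# → laplaceTerm M j ≈ 0#
  laplaceTerm-zero M j entry≈0 = trans (*-congˡ (trans (*-congʳ entry≈0) (zeroˡ _))) (zeroʳ _)

  det-cong : ∀ n {M N : Matrix n} → (∀ i j → M i j ≈ N i j) → det R n M ≈ det R n N
  det-cong zero    M≈N = refl
  det-cong (suc n) {M} {N} M≈N = begin
    det R (suc n) M  ≡⟨ det-expand n M ⟩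
    sum (laplaceTerm M)  ≈⟨ sum-cong-≋ (λ j → *-congˡ {sign j} (*-cong (M≈N Fin.zero j)
                                                 (det-cong n (λ r s → M≈N (Fin.suc r) (punchIn j s))))) ⟩
    sum (laplaceTerm N)  ≡⟨ det-expand n N ⟨
    det R (suc n) N  ∎

  TransposeInvariant : ℕ → Set (c ⊔ ℓ)
  TransposeInvariant n = ∀ (M : Matrix n) → det R n M ≈ det R n (transpose M)

  det-transpose-step : ∀ n → TransposeInvariant (suc n) → TransposeInvariant n →
                       TransposeInvariant (suc (suc n))
  det-transpose-step n det-transpose₁ det-transpose₀ M = begin
    det R (suc (suc n)) M                                                     ≡⟨ det-expand (suc n) M ⟩
    laplaceTerm M Fin.zero + sum (λ j → laplaceTerm M (Fin.suc j))            ≈⟨ +-cong first-terms other-terms ⟩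
    laplaceTerm Mᵀ Fin.zero + sum (λ i → laplaceTerm Mᵀ (Fin.suc i))          ≡⟨ det-expand (suc n) Mᵀ ⟨
    det R (suc (suc n)) Mᵀ                                                    ∎
    where
    Mᵀ = transpose M
    a b : Fin (suc n) → Carrier
    a j = M Fin.zero (Fin.suc j)
    b i = M (Fin.suc i) Fin.zero
    D : Fin (suc n) → Fin (suc n) → Carrier
    D i j = det R n (λ r s → M (Fin.suc (punchIn i r)) (Fin.suc (punchIn j s)))
    expand-column : ∀ j → det R (suc n) (minor (Fin.suc j) M) ≈ sum (λ i → sign i * (b i * D i j))
    expand-column j = begin
      det R (suc n) (minor (Fin.suc j) M)               ≈⟨ det-transpose₁ (minor (Fin.suc j) M) ⟩
      det R (suc n) (transpose (minor (Fin.suc j) M))   ≡⟨ det-expand n (transpose (minor (Fin.suc j) M)) ⟩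
      sum (λ i → sign i * (b i * det R n (minor i (transpose (minor (Fin.suc j) M)))))
        ≈⟨ sum-cong-≋ (λ i → *-congˡ {sign i} (*-congˡ {b i}
                                                              (det-transpose₀ (minor i (transpose (minor (Fin.suc j) M)))))) ⟩
      sum (λ i → sign i * (b i * D i j))                 ∎
    expand-row : ∀ i → det R (suc n) (minor (Fin.suc i) Mᵀ) ≈ sum (λ j → sign j * (a j * D i j))
    expand-row i = begin
      det R (suc n) (minor (Fin.suc i) Mᵀ)               ≈⟨ det-transpose₁ (minor (Fin.suc i) Mᵀ) ⟩
      det R (suc n) (transpose (minor (Fin.suc i) Mᵀ))   ≡⟨ det-expand n (transpose (minor (Fin.suc i) Mᵀ)) ⟩
      sum (λ j → sign j * (a j * D i j))                             ∎
    pull-into-sum : ∀ y z (f : Fin (suc n) → Carrier) → y * (z * sum f) ≈ sum (λ k → y * (z * f k))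
    pull-into-sum y z f = trans (*-congˡ (*-distribˡ-sum z f)) (*-distribˡ-sum y (λ k → z * f k))
    swap-signs : ∀ sⱼ sᵢ aⱼ bᵢ d → (- 1# * sⱼ) * (aⱼ * (sᵢ * (bᵢ * d))) ≈ (- 1# * sᵢ) * (bᵢ * (sⱼ * (aⱼ * d)))
    swap-signs = solve 5 (λ sⱼ sᵢ aⱼ bᵢ d → (:- con (+ 1) :* sⱼ) :* (aⱼ :* (sᵢ :* (bᵢ :* d)))
                                         := (:- con (+ 1) :* sᵢ) :* (bᵢ :* (sⱼ :* (aⱼ :* d)))) refl

    first-terms : laplaceTerm M Fin.zero ≈ laplaceTerm Mᵀ Fin.zero
    first-terms = *-congˡ (*-congˡ (det-transpose₁ (minor Fin.zero M)))
    other-terms : sum (λ j → laplaceTerm M (Fin.suc j)) ≈ sum (λ i → laplaceTerm Mᵀ (Fin.suc i))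
    other-terms = begin
      sum (λ j → sign (Fin.suc j) * (a j * det R (suc n) (minor (Fin.suc j) M)))
        ≈⟨ sum-cong-≋ (λ j → *-congˡ {sign (Fin.suc j)} (*-congˡ {a j} (expand-column j))) ⟩
      sum (λ j → sign (Fin.suc j) * (a j * sum (λ i → sign i * (b i * D i j))))
        ≈⟨ sum-cong-≋ (λ j → pull-into-sum (sign (Fin.suc j)) (a j) (λ i → sign i * (b i * D i j))) ⟩
      sum (λ j → sum (λ i → sign (Fin.suc j) * (a j * (sign i * (b i * D i j)))))
        ≈⟨ ∑-comm (λ j i → sign (Fin.suc j) * (a j * (sign i * (b i * D i j)))) ⟩
      sum (λ i → sum (λ j → sign (Fin.suc j) * (a j * (sign i * (b i * D i j)))))
        ≈⟨ sum-cong-≋ (λ i → sum-cong-≋ (λ j → swap-signs (sign j) (sign i) (a j) (b i) (D i j))) ⟩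
      sum (λ i → sum (λ j → sign (Fin.suc i) * (b i * (sign j * (a j * D i j)))))
        ≈⟨ sum-cong-≋ (λ i → pull-into-sum (sign (Fin.suc i)) (b i) (λ j → sign j * (a j * D i j))) ⟨
      sum (λ i → sign (Fin.suc i) * (b i * sum (λ j → sign j * (a j * D i j))))
        ≈⟨ sum-cong-≋ (λ i → *-congˡ {sign (Fin.suc i)} (*-congˡ {b i} (expand-row i))) ⟨
      sum (λ i → sign (Fin.suc i) * (b i * det R (suc n) (minor (Fin.suc i) Mᵀ)))   ∎
  det-transpose : ∀ n → TransposeInvariant n
  det-transpose zero          M = refl
  det-transpose (suc zero)    M = refl
  det-transpose (suc (suc n))   = det-transpose-step n (det-transpose (suc n)) (det-transpose n)

  det-zero-row : ∀ n (M : Matrix n) i → (∀ j → M i j ≈ 0#) → det R n M ≈ 0#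
  det-zero-row (suc n) M i row≈0 = begin
    det R (suc n) M      ≡⟨ det-expand n M ⟩
    sum (laplaceTerm M)  ≈⟨ sum-zero (laplaceTerm M) (term≈0 i row≈0) ⟩
    0#                   ∎
    where
    term≈0 : ∀ i → (∀ j → M i j ≈ 0#) → ∀ j → laplaceTerm M j ≈ 0#
    term≈0 Fin.zero    row≈0 j = laplaceTerm-zero M j (row≈0 j)
    term≈0 (Fin.suc i) row≈0 j = trans (*-congˡ (trans (*-congˡ minor≈0) (zeroʳ _))) (zeroʳ _)
      where minor≈0 = det-zero-row n (minor j M) i (λ s → row≈0 (punchIn j s))

  sign-inject₁ : ∀ {n} (k : Fin n) → sign (inject₁ k) ≡ sign k
  sign-inject₁ k = ≡.cong ((- 1#) ^_) (Fin.toℕ-inject₁ k)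

  sign-fromℕ : ∀ n → sign (fromℕ n) ≡ (- 1#) ^ n
  sign-fromℕ n = ≡.cong ((- 1#) ^_) (Fin.toℕ-fromℕ n)

  det-singleton : (M : Matrix 1) → det R 1 M ≈ M Fin.zero Fin.zero
  det-singleton M = solve 1 (λ m → con (+ 1) :* (m :* con (+ 1)) :+ con (+ 0) := m) refl (M Fin.zero Fin.zero)

  upperLeft : ∀ {n} → Matrix (suc n) → Matrix n
  upperLeft M r s = M (inject₁ r) (inject₁ s)

  det-lastRow : ∀ n (M : Matrix (suc n)) → (∀ j → j ≢ fromℕ n → M (fromℕ n) j ≈ 0#) →
                det R (suc n) M ≈ det R n (upperLeft M) * M (fromℕ n) (fromℕ n)
  det-lastRow zero    M _ = trans (det-singleton M) (sym (*-identityˡ _))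
  det-lastRow (suc n) M lastRow≈0 = begin
    det R (suc (suc n)) M                                          ≡⟨ det-expand (suc n) M ⟩
    sum (laplaceTerm M)                                            ≈⟨ sum-init-last (laplaceTerm M) ⟩
    sum (λ k → laplaceTerm M (inject₁ k)) + laplaceTerm M (fromℕ (suc n))
      ≈⟨ +-cong (sum-cong-≋ inner-term) last-term≈0 ⟩
    sum (λ k → laplaceTerm (upperLeft M) k * corner) + 0#          ≈⟨ +-identityʳ _ ⟩
    sum (λ k → laplaceTerm (upperLeft M) k * corner)               ≈⟨ *-distribʳ-sum corner (laplaceTerm (upperLeft M)) ⟨
    sum (laplaceTerm (upperLeft M)) * corner                       ≡⟨ ≡.cong (_* corner) (det-expand n (upperLeft M)) ⟨
    det R (suc n) (upperLeft M) * corner                           ∎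
    where
    corner = M (fromℕ (suc n)) (fromℕ (suc n))
    last-term≈0 : laplaceTerm M (fromℕ (suc n)) ≈ 0#
    last-term≈0 = trans (*-congˡ (trans (*-congˡ minor≈0) (zeroʳ _))) (zeroʳ _)
      where
      minor≈0 = det-zero-row (suc n) (minor (fromℕ (suc n)) M) (fromℕ n) λ s →
        ≡.subst (λ t → M (fromℕ (suc n)) t ≈ 0#) (≡.sym (punchIn-fromℕ s))
          (lastRow≈0 (inject₁ s) (Fin.fromℕ≢inject₁ ∘ ≡.sym))
    inner-term : ∀ k → laplaceTerm M (inject₁ k) ≈ laplaceTerm (upperLeft M) k * corner
    inner-term k = begin
      sign (inject₁ k) * (M Fin.zero (inject₁ k) * det R (suc n) (minor (inject₁ k) M))
        ≈⟨ *-cong (reflexive (sign-inject₁ k)) (*-congˡ (det-lastRow n (minor (inject₁ k) M) minor-lastRow≈0)) ⟩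
      sign k * (M Fin.zero (inject₁ k) * (det R n (upperLeft (minor (inject₁ k) M)) * M (fromℕ (suc n)) (punchIn (inject₁ k) (fromℕ n))))
        ≈⟨ *-congˡ (*-congˡ (*-cong
             (det-cong n λ r s → reflexive (≡.cong (M (Fin.suc (inject₁ r))) (punchIn-inject₁-inject₁ k s)))
             (reflexive (≡.cong (M (fromℕ (suc n))) (punchIn-inject₁-fromℕ k))))) ⟩
      sign k * (M Fin.zero (inject₁ k) * (det R n (minor k (upperLeft M)) * corner))
        ≈⟨ solve 4 (λ σ m d e → σ :* (m :* (d :* e)) := σ :* (m :* d) :* e) refl _ _ _ _ ⟩
      laplaceTerm (upperLeft M) k * corner                         ∎
      where
      minor-lastRow≈0 : ∀ s → s ≢ fromℕ n → M (fromℕ (suc n)) (punchIn (inject₁ k) s) ≈ 0#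
      minor-lastRow≈0 s s≢last = lastRow≈0 _ λ eq →
        s≢last (Fin.punchIn-injective (inject₁ k) s (fromℕ n) (≡.trans eq (≡.sym (punchIn-inject₁-fromℕ k))))

module RangeSum {c ℓ : Level} (R : CommutativeRing c ℓ) where
  open CommutativeRing R
  open import Algebra.Properties.Semiring.Sum semiring using (sum; sum-cong-≋; sum-cong-≗; sum-init-last; ∑-distrib-+; *-distribˡ-sum)
  open import Relation.Binary.Reasoning.Setoid setoid

  sumℕ : ℕ → (ℕ → Carrier) → Carrier
  sumℕ N g = sum (λ (j : Fin N) → g (toℕ j))

  sumℕ-cong : ∀ N {g h : ℕ → Carrier} → (∀ j → j < N → g j ≈ h j) → sumℕ N g ≈ sumℕ N h
  sumℕ-cong N g≈h = sum-cong-≋ (λ j → g≈h (toℕ j) (Fin.toℕ<n j))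

  sumℕ-suc : ∀ N g → sumℕ (suc N) g ≈ sumℕ N g + g N
  sumℕ-suc N g = begin
    sumℕ (suc N) g                                             ≈⟨ sum-init-last {N} (λ j → g (toℕ j)) ⟩
    sum {N} (λ j → g (toℕ (inject₁ j))) + g (toℕ (fromℕ N))     ≡⟨ ≡.cong₂ _+_ (sum-cong-≗ {N} (≡.cong g ∘ Fin.toℕ-inject₁))
                                                                                (≡.cong g (Fin.toℕ-fromℕ N)) ⟩
    sumℕ N g + g N                                             ∎

  sumℕ-+ : ∀ N g h → sumℕ N (λ j → g j + h j) ≈ sumℕ N g + sumℕ N h
  sumℕ-+ N g h = ∑-distrib-+ {N} (λ j → g (toℕ j)) (λ j → h (toℕ j))

  sumℕ-*ˡ : ∀ N y g → sumℕ N (λ j → y * g j) ≈ y * sumℕ N g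
  sumℕ-*ˡ N y g = sym (*-distribˡ-sum {N} y (λ j → g (toℕ j)))

  sumℕ-extend : ∀ K d g → (∀ j → K ≤ j → g j ≈ 0#) → sumℕ (K ℕ.+ d) g ≈ sumℕ K g
  sumℕ-extend K zero    g vanish = reflexive (≡.cong (λ N → sumℕ N g) (ℕ.+-identityʳ K))
  sumℕ-extend K (suc d) g vanish = begin
    sumℕ (K ℕ.+ suc d) g               ≡⟨ ≡.cong (λ N → sumℕ N g) (ℕ.+-suc K d) ⟩
    sumℕ (suc (K ℕ.+ d)) g             ≈⟨ sumℕ-suc (K ℕ.+ d) g ⟩
    sumℕ (K ℕ.+ d) g + g (K ℕ.+ d)     ≈⟨ +-cong (sumℕ-extend K d g vanish) (vanish (K ℕ.+ d) (ℕ.m≤m+n K d)) ⟩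
    sumℕ K g + 0#                      ≈⟨ +-identityʳ _ ⟩
    sumℕ K g                           ∎

  sumℕ-limits : ∀ K N g → (∀ j → K ≤ j ⊎ N ≤ j → g j ≈ 0#) → sumℕ K g ≈ sumℕ N g
  sumℕ-limits K N g vanish with ℕ.≤-total K N
  ... | inj₁ K≤N = sym (≡.subst (λ M → sumℕ M g ≈ sumℕ K g) (ℕ.m+[n∸m]≡n K≤N)
                          (sumℕ-extend K (N ∸ K) g (λ j → vanish j ∘ inj₁)))
  ... | inj₂ N≤K = ≡.subst (λ M → sumℕ M g ≈ sumℕ N g) (ℕ.m+[n∸m]≡n N≤K)
                     (sumℕ-extend N (K ∸ N) g (λ j → vanish j ∘ inj₂))

  Σ1≈sumℕ : ∀ L F → Σ1 R L F ≈ sumℕ L (λ j → F (suc j))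
  Σ1≈sumℕ zero    F = refl
  Σ1≈sumℕ (suc L) F = trans (+-congʳ (Σ1≈sumℕ L F)) (sym (sumℕ-suc L (λ j → F (suc j))))

module Recurrence {c ℓ : Level} (R : CommutativeRing c ℓ) (x : CommutativeRing.Carrier R) where
  open CommutativeRing R
  open IntegerCoefficients R
  open import Relation.Binary.Reasoning.Setoid setoid

  Recurrent : (ℕ → Carrier) → Set ℓ
  Recurrent s = ∀ m → s (suc (suc m)) ≈ x * x * (s (suc m) - s m)

  recurrent-unique : ∀ {u v} → Recurrent u → Recurrent v → u 0 ≈ v 0 → u 1 ≈ v 1 → ∀ m → u m ≈ v m
  recurrent-unique ru rv u₀≈v₀ u₁≈v₁ zero          = u₀≈v₀
  recurrent-unique ru rv u₀≈v₀ u₁≈v₁ (suc zero)    = u₁≈v₁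
  recurrent-unique {u} {v} ru rv u₀≈v₀ u₁≈v₁ (suc (suc m)) = begin
    u (suc (suc m))                  ≈⟨ ru m ⟩
    x * x * (u (suc m) - u m)        ≈⟨ *-congˡ (+-cong (recurrent-unique ru rv u₀≈v₀ u₁≈v₁ (suc m))
                                                          (-‿cong (recurrent-unique ru rv u₀≈v₀ u₁≈v₁ m))) ⟩
    x * x * (v (suc m) - v m)        ≈⟨ rv m ⟨
    v (suc (suc m))                  ∎

  recurrent-combination : ∀ {s} y z → Recurrent s → Recurrent (λ m → y * s (suc m) - z * s m)
  recurrent-combination {s} y z rs m = begin
    y * s (suc (suc (suc m))) - z * s (suc (suc m))
      ≈⟨ +-cong (*-congˡ (rs (suc m))) (-‿cong (*-congˡ (rs m))) ⟩
    y * (x * x * (s (suc (suc m)) - s (suc m))) - z * (x * x * (s (suc m) - s m))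
      ≈⟨ solve 6 (λ X Y Z s₂ s₁ s₀ → Y :* (X :* X :* (s₂ :- s₁)) :- Z :* (X :* X :* (s₁ :- s₀))
                                    := X :* X :* ((Y :* s₂ :- Z :* s₁) :- (Y :* s₁ :- Z :* s₀)))
           refl x y z (s (suc (suc m))) (s (suc m)) (s m) ⟩
    x * x * ((y * s (suc (suc m)) - z * s (suc m)) - (y * s (suc m) - z * s m)) ∎

module CharacteristicPolynomial {c ℓ : Level} (R : CommutativeRing c ℓ) (x : CommutativeRing.Carrier R) where
  open CommutativeRing R
  open RawSemiring (Semiring.rawSemiring semiring) using (_^_)
  open import Algebra.Properties.Semiring.Sum semiring using (sum)
  open import Relation.Binary.Reasoning.Setoid setoid
  open IntegerCoefficients R
  open Determinant R
  open Recurrence R x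

  indicator : ∀ {p} {P : Set p} → Dec P → Carrier
  indicator (yes _) = 1#
  indicator (no _)  = 0#

  indicator-yes : ∀ {p} {P : Set p} (p? : Dec P) → P → indicator p? ≈ 1#
  indicator-yes (yes _) _  = refl
  indicator-yes (no ¬p) p  = contradiction p ¬p

  indicator-no : ∀ {p} {P : Set p} (p? : Dec P) → ¬ P → indicator p? ≈ 0#
  indicator-no (yes p) ¬p = contradiction p ¬p
  indicator-no (no _)  _  = refl

  indicator-cong : ∀ {p q} {P : Set p} {Q : Set q} (p? : Dec P) (q? : Dec Q) → (P → Q) → (Q → P) →
                   indicator p? ≈ indicator q?
  indicator-cong p? (yes q) _   Q→P = indicator-yes p? (Q→P q)
  indicator-cong p? (no ¬q) P→Q _   = indicator-no p? (¬q ∘ P→Q)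

  -- The 0-based positions of the ones of A_n, decided exactly as in Amat.
  onLines? : ∀ n a b → Dec ((b ≡ suc a) ⊎ (suc a ℕ.+ suc b ≡ suc n))
  onLines? n a b = (b ℕ.≟ suc a) ⊎-dec (suc a ℕ.+ suc b ℕ.≟ suc n)

  -- Entry (a, b) of xI − A_n, 0-based, defined for all a b : ℕ so that minors are described by shifts.
  entry : ℕ → ℕ → ℕ → Carrier
  entry n a b = x * indicator (a ℕ.≟ b) - indicator (onLines? n a b)

  antidiagonal : ∀ {n a b} → suc a ℕ.+ suc b ≡ suc n → suc (a ℕ.+ b) ≡ n
  antidiagonal {n} {a} {b} eq = ≡.trans (≡.sym (ℕ.+-suc a b)) (ℕ.suc-injective eq)

  entry-diagonal : ∀ n a → a ≢ suc a → suc (a ℕ.+ a) ≢ n → entry n a a ≈ x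
  entry-diagonal n a a≢1+a off-antidiagonal = begin
    x * indicator (a ℕ.≟ a) - indicator (onLines? n a a)
      ≈⟨ +-cong (*-congˡ (indicator-yes (a ℕ.≟ a) ≡.refl)) (-‿cong (indicator-no (onLines? n a a) off-lines)) ⟩
    x * 1# - 0#
      ≈⟨ solve 1 (λ y → y :* con (+ 1) :- con (+ 0) := y) refl x ⟩
    x ∎
    where
    off-lines : ¬ ((a ≡ suc a) ⊎ (suc a ℕ.+ suc a ≡ suc n))
    off-lines (inj₁ eq) = a≢1+a eq
    off-lines (inj₂ eq) = off-antidiagonal (antidiagonal eq)

  entry-zero : ∀ n a b → a ≢ b → b ≢ suc a → suc (a ℕ.+ b) ≢ n → entry n a b ≈ 0#
  entry-zero n a b a≢b off-superdiagonal off-antidiagonal = begin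
    x * indicator (a ℕ.≟ b) - indicator (onLines? n a b)
      ≈⟨ +-cong (*-congˡ (indicator-no (a ℕ.≟ b) a≢b)) (-‿cong (indicator-no (onLines? n a b) off-lines)) ⟩
    x * 0# - 0#
      ≈⟨ solve 1 (λ y → y :* con (+ 0) :- con (+ 0) := con (+ 0)) refl x ⟩
    0# ∎
    where
    off-lines : ¬ ((b ≡ suc a) ⊎ (suc a ℕ.+ suc b ≡ suc n))
    off-lines (inj₁ eq) = off-superdiagonal eq
    off-lines (inj₂ eq) = off-antidiagonal (antidiagonal eq)

  entry-minus-one : ∀ n a b → a ≢ b → (b ≡ suc a) ⊎ (suc (a ℕ.+ b) ≡ n) → entry n a b ≈ - 1#
  entry-minus-one n a b a≢b on-line = begin
    x * indicator (a ℕ.≟ b) - indicator (onLines? n a b)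
      ≈⟨ +-cong (*-congˡ (indicator-no (a ℕ.≟ b) a≢b)) (-‿cong (indicator-yes (onLines? n a b) (on-lines on-line))) ⟩
    x * 0# - 1#
      ≈⟨ solve 1 (λ y → y :* con (+ 0) :- con (+ 1) := :- con (+ 1)) refl x ⟩
    - 1# ∎
    where
    on-lines : (b ≡ suc a) ⊎ (suc (a ℕ.+ b) ≡ n) → (b ≡ suc a) ⊎ (suc a ℕ.+ suc b ≡ suc n)
    on-lines (inj₁ eq) = inj₁ eq
    on-lines (inj₂ eq) = inj₂ (≡.cong suc (≡.trans (ℕ.+-suc a b) eq))

  entry-shift : ∀ n a b → entry (suc (suc n)) (suc a) (suc b) ≈ entry n a b
  entry-shift n a b = +-cong
    (*-congˡ (indicator-cong (suc a ℕ.≟ suc b) (a ℕ.≟ b) ℕ.suc-injective (≡.cong suc)))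
    (-‿cong (indicator-cong (onLines? (suc (suc n)) (suc a) (suc b)) (onLines? n a b) down up))
    where
    down : (suc b ≡ suc (suc a)) ⊎ (suc (suc a) ℕ.+ suc (suc b) ≡ suc (suc (suc n))) →
           (b ≡ suc a) ⊎ (suc a ℕ.+ suc b ≡ suc n)
    down (inj₁ eq) = inj₁ (ℕ.suc-injective eq)
    down (inj₂ eq) = inj₂ (≡.trans (≡.sym (ℕ.+-suc a (suc b))) (ℕ.suc-injective (ℕ.suc-injective eq)))
    up : (b ≡ suc a) ⊎ (suc a ℕ.+ suc b ≡ suc n) →
         (suc b ≡ suc (suc a)) ⊎ (suc (suc a) ℕ.+ suc (suc b) ≡ suc (suc (suc n)))
    up (inj₁ eq) = inj₁ (≡.cong suc eq)
    up (inj₂ eq) = inj₂ (≡.cong (suc ∘ suc) (≡.trans (ℕ.+-suc a (suc b)) eq))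

  charMatrix : ∀ n → Matrix n
  charMatrix n i j = entry n (toℕ i) (toℕ j)

  χ : ℕ → Carrier
  χ n = det R n (charMatrix n)

  -- ψ p is the minor of xI − A_{p+1} obtained by deleting its last row and its first column.
  ψMatrix : ∀ p → Matrix p
  ψMatrix p i j = entry (suc p) (toℕ i) (suc (toℕ j))

  ψ : ℕ → Carrier
  ψ p = det R p (ψMatrix p)

  identity≈indicator : ∀ n (i j : Fin n) → identity R n i j ≈ indicator (toℕ i ℕ.≟ toℕ j)
  identity≈indicator n i j with i Fin.≟ j
  ... | yes i≡j = sym (indicator-yes (toℕ i ℕ.≟ toℕ j) (≡.cong toℕ i≡j))
  ... | no i≢j  = sym (indicator-no (toℕ i ℕ.≟ toℕ j) (i≢j ∘ Fin.toℕ-injective))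

  Amat≈indicator : ∀ n (i j : Fin n) → Amat R n i j ≈ indicator (onLines? n (toℕ i) (toℕ j))
  Amat≈indicator n i j with (toℕ j ℕ.≟ suc (toℕ i)) ⊎-dec (suc (toℕ i) ℕ.+ suc (toℕ j) ℕ.≟ suc n)
  ... | yes _ = refl
  ... | no _  = refl

  charPoly≈χ : ∀ n → charPoly R n x ≈ χ n
  charPoly≈χ n = det-cong n λ i j → +-cong (*-congˡ (identity≈indicator n i j)) (-‿cong (Amat≈indicator n i j))

  toℕ≢ : ∀ {k} {j : Fin (suc k)} → j ≢ fromℕ k → toℕ j ≢ k
  toℕ≢ {k} j≢last eq = j≢last (Fin.toℕ-injective (≡.trans eq (≡.sym (Fin.toℕ-fromℕ k))))

  det-bordered : ∀ k → det R (suc k) (λ r s → entry k (toℕ r) (toℕ s)) ≈ χ k * x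
  det-bordered k = begin
    det R (suc k) B                                         ≈⟨ det-lastRow k B lastRow≈0 ⟩
    det R k (upperLeft B) * B (fromℕ k) (fromℕ k)          ≈⟨ *-cong (det-cong k inject₁-entries) corner ⟩
    χ k * x                                                 ∎
    where
    B : Matrix (suc k)
    B r s = entry k (toℕ r) (toℕ s)
    lastRow≈0 : ∀ j → j ≢ fromℕ k → B (fromℕ k) j ≈ 0#
    lastRow≈0 j j≢last = ≡.subst (λ t → entry k t (toℕ j) ≈ 0#) (≡.sym (Fin.toℕ-fromℕ k))
      (entry-zero k k (toℕ j) (toℕ≢ j≢last ∘ ≡.sym) (ℕ.<⇒≢ (Fin.toℕ<n j)) (ℕ.m≢1+m+n k ∘ ≡.sym))
    corner : B (fromℕ k) (fromℕ k) ≈ x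
    corner = ≡.subst (λ t → entry k t t ≈ x) (≡.sym (Fin.toℕ-fromℕ k))
      (entry-diagonal k k (ℕ.1+n≢n ∘ ≡.sym) (ℕ.m≢1+m+n k ∘ ≡.sym))
    inject₁-entries : ∀ r s → upperLeft B r s ≈ charMatrix k r s
    inject₁-entries r s = reflexive (≡.cong₂ (entry k) (Fin.toℕ-inject₁ r) (Fin.toℕ-inject₁ s))

  χ-suc² : ∀ k → χ (suc (suc k)) ≈ x * x * χ k + (- 1#) ^ k * ψ (suc k)
  χ-suc² k = begin
    χ (suc (suc k))                                               ≈⟨ det-transpose (suc (suc k)) (charMatrix (suc (suc k))) ⟩
    det R (suc (suc k)) Mᵀ                                        ≡⟨ det-expand (suc k) Mᵀ ⟩
    sum (laplaceTerm Mᵀ)                                          ≈⟨ sum-first-last (laplaceTerm Mᵀ) middle≈0 ⟩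
    laplaceTerm Mᵀ Fin.zero + laplaceTerm Mᵀ (fromℕ (suc k))     ≈⟨ +-cong first-term last-term ⟩
    1# * (x * (χ k * x)) + (- 1#) ^ suc k * (- 1# * ψ (suc k))
      ≈⟨ solve 4 (λ X C σ P → con (+ 1) :* (X :* (C :* X)) :+ (:- con (+ 1) :* σ) :* (:- con (+ 1) :* P)
                           := X :* X :* C :+ σ :* P) refl x (χ k) ((- 1#) ^ k) (ψ (suc k)) ⟩
    x * x * χ k + (- 1#) ^ k * ψ (suc k)                          ∎
    where
    n = suc (suc k)
    Mᵀ = transpose (charMatrix n)
    middle≈0 : ∀ j → laplaceTerm Mᵀ (Fin.suc (inject₁ j)) ≈ 0#
    middle≈0 j = laplaceTerm-zero Mᵀ (Fin.suc (inject₁ j)) (entry-zero n (suc t) 0 (λ ()) (λ ()) off-antidiagonal)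
      where
      t = toℕ (inject₁ j)
      off-antidiagonal : suc (suc t ℕ.+ 0) ≢ n
      off-antidiagonal eq = Fin.toℕ-inject₁-≢ j (≡.trans (≡.sym (ℕ.suc-injective (ℕ.suc-injective eq))) (ℕ.+-identityʳ t))
    first-term : laplaceTerm Mᵀ Fin.zero ≈ 1# * (x * (χ k * x))
    first-term = *-congˡ (*-cong (entry-diagonal n 0 (λ ()) (λ ())) (begin
      det R (suc k) (minor Fin.zero Mᵀ)                              ≈⟨ det-transpose (suc k) (minor Fin.zero Mᵀ) ⟩
      det R (suc k) (λ r s → entry n (suc (toℕ r)) (suc (toℕ s)))    ≈⟨ det-cong (suc k) (λ r s → entry-shift k (toℕ r) (toℕ s)) ⟩
      det R (suc k) (λ r s → entry k (toℕ r) (toℕ s))                ≈⟨ det-bordered k ⟩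
      χ k * x                                                        ∎))
    last-term : laplaceTerm Mᵀ (fromℕ (suc k)) ≈ (- 1#) ^ suc k * (- 1# * ψ (suc k))
    last-term = *-cong (reflexive (sign-fromℕ (suc k))) (*-cong
      (≡.subst (λ t → entry n t 0 ≈ - 1#) (≡.sym (Fin.toℕ-fromℕ (suc k)))
        (entry-minus-one n (suc k) 0 (λ ()) (inj₂ (≡.cong (suc ∘ suc) (ℕ.+-identityʳ k)))))
      (begin
        det R (suc k) (minor (fromℕ (suc k)) Mᵀ)        ≈⟨ det-cong (suc k) (λ r s → reflexive (≡.cong (λ t → entry n t (suc (toℕ r)))
                                                              (≡.trans (≡.cong toℕ (punchIn-fromℕ s)) (Fin.toℕ-inject₁ s)))) ⟩
        det R (suc k) (transpose (ψMatrix (suc k)))     ≈⟨ det-transpose (suc k) (ψMatrix (suc k)) ⟨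
        ψ (suc k)                                       ∎))

  ψ-suc² : ∀ k → ψ (suc (suc k)) ≈ ψ k + (- 1#) ^ k * χ (suc k)
  ψ-suc² k = begin
    ψ (suc (suc k))                                             ≡⟨ det-expand (suc k) N ⟩
    sum (laplaceTerm N)                                         ≈⟨ sum-first-last (laplaceTerm N) middle≈0 ⟩
    laplaceTerm N Fin.zero + laplaceTerm N (fromℕ (suc k))     ≈⟨ +-cong first-term last-term ⟩
    1# * (- 1# * (ψ k * - 1#)) + (- 1#) ^ suc k * (- 1# * χ (suc k))
      ≈⟨ solve 3 (λ Y σ X → con (+ 1) :* (:- con (+ 1) :* (Y :* :- con (+ 1))) :+ (:- con (+ 1) :* σ) :* (:- con (+ 1) :* X)
                         := Y :+ σ :* X) refl (ψ k) ((- 1#) ^ k) (χ (suc k)) ⟩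
    ψ k + (- 1#) ^ k * χ (suc k)                                ∎
    where
    n = suc (suc (suc k))
    N = ψMatrix (suc (suc k))
    middle≈0 : ∀ j → laplaceTerm N (Fin.suc (inject₁ j)) ≈ 0#
    middle≈0 j = laplaceTerm-zero N (Fin.suc (inject₁ j)) (entry-zero n 0 (suc (suc t)) (λ ()) (λ ()) off-antidiagonal)
      where
      t = toℕ (inject₁ j)
      off-antidiagonal : suc (suc (suc t)) ≢ n
      off-antidiagonal eq = Fin.toℕ-inject₁-≢ j (≡.sym (ℕ.suc-injective (ℕ.suc-injective (ℕ.suc-injective eq))))
    Z : Matrix (suc k)
    Z r s = entry (suc k) (toℕ r) (suc (toℕ s))
    Zᵀ-lastRow≈0 : ∀ j → j ≢ fromℕ k → Z j (fromℕ k) ≈ 0#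
    Zᵀ-lastRow≈0 j j≢last = ≡.subst (λ t → entry (suc k) (toℕ j) (suc t) ≈ 0#) (≡.sym (Fin.toℕ-fromℕ k))
      (entry-zero (suc k) (toℕ j) (suc k) (ℕ.<⇒≢ (Fin.toℕ<n j)) (toℕ≢ j≢last ∘ ≡.sym ∘ ℕ.suc-injective)
        (ℕ.m≢1+n+m (suc k) ∘ ≡.sym))
    Z-corner : Z (fromℕ k) (fromℕ k) ≈ - 1#
    Z-corner = ≡.subst (λ t → entry (suc k) t (suc t) ≈ - 1#) (≡.sym (Fin.toℕ-fromℕ k))
      (entry-minus-one (suc k) k (suc k) (ℕ.1+n≢n ∘ ≡.sym) (inj₁ ≡.refl))
    first-term : laplaceTerm N Fin.zero ≈ 1# * (- 1# * (ψ k * - 1#))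
    first-term = *-congˡ (*-cong (entry-minus-one n 0 1 (λ ()) (inj₁ ≡.refl)) (begin
      det R (suc k) (minor Fin.zero N)                     ≈⟨ det-cong (suc k) (λ r s → entry-shift (suc k) (toℕ r) (suc (toℕ s))) ⟩
      det R (suc k) Z                                      ≈⟨ det-transpose (suc k) Z ⟩
      det R (suc k) (transpose Z)                          ≈⟨ det-lastRow k (transpose Z) Zᵀ-lastRow≈0 ⟩
      det R k (upperLeft (transpose Z)) * Z (fromℕ k) (fromℕ k)
        ≈⟨ *-cong (det-cong k (λ r s → reflexive (≡.cong₂ (λ a b → entry (suc k) a (suc b))
                                                                (Fin.toℕ-inject₁ s) (Fin.toℕ-inject₁ r))))
                  Z-corner ⟩
      det R k (transpose (ψMatrix k)) * - 1#               ≈⟨ *-congʳ (det-transpose k (ψMatrix k)) ⟨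
      ψ k * - 1#                                           ∎))
    last-term : laplaceTerm N (fromℕ (suc k)) ≈ (- 1#) ^ suc k * (- 1# * χ (suc k))
    last-term = *-cong (reflexive (sign-fromℕ (suc k))) (*-cong
      (≡.subst (λ t → entry n 0 (suc t) ≈ - 1#) (≡.sym (Fin.toℕ-fromℕ (suc k)))
        (entry-minus-one n 0 (suc (suc k)) (λ ()) (inj₂ ≡.refl)))
      (det-cong (suc k) λ r s → trans
        (reflexive (≡.cong (λ t → entry n (suc (toℕ r)) (suc t)) (≡.trans (≡.cong toℕ (punchIn-fromℕ s)) (Fin.toℕ-inject₁ s))))
        (entry-shift (suc k) (toℕ r) (toℕ s))))

  sign²≈1 : ∀ j → (- 1#) ^ j * (- 1#) ^ j ≈ 1#
  sign²≈1 zero    = *-identityˡ 1#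
  sign²≈1 (suc j) = trans (solve 1 (λ σ → (:- con (+ 1) :* σ) :* (:- con (+ 1) :* σ) := σ :* σ) refl ((- 1#) ^ j)) (sign²≈1 j)

  χ-recurrence : ∀ j → χ (4 ℕ.+ j) ≈ x * x * (χ (2 ℕ.+ j) - χ j)
  χ-recurrence j = begin
    χ (4 ℕ.+ j)                                                     ≈⟨ χ-suc² (2 ℕ.+ j) ⟩
    x * x * χ (2 ℕ.+ j) + σ″ * ψ (3 ℕ.+ j)                          ≈⟨ +-congˡ (*-congˡ (ψ-suc² (suc j))) ⟩
    x * x * χ (2 ℕ.+ j) + σ″ * (ψ (suc j) + σ′ * χ (2 ℕ.+ j))
      ≈⟨ solve 4 (λ X σ Y Z → X :* X :* Z :+ (:- con (+ 1) :* (:- con (+ 1) :* σ)) :* (Y :+ (:- con (+ 1) :* σ) :* Z)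
                            := X :* X :* Z :+ σ :* Y :- σ :* σ :* Z) refl x σ (ψ (suc j)) (χ (2 ℕ.+ j)) ⟩
    x * x * χ (2 ℕ.+ j) + σ * ψ (suc j) - σ * σ * χ (2 ℕ.+ j)       ≈⟨ +-congˡ (-‿cong (*-congʳ (sign²≈1 j))) ⟩
    x * x * χ (2 ℕ.+ j) + σ * ψ (suc j) - 1# * χ (2 ℕ.+ j)          ≈⟨ +-congˡ (-‿cong (*-congˡ (χ-suc² j))) ⟩
    x * x * χ (2 ℕ.+ j) + σ * ψ (suc j) - 1# * (x * x * χ j + σ * ψ (suc j))
      ≈⟨ solve 4 (λ X σY Z W → X :* X :* Z :+ σY :- con (+ 1) :* (X :* X :* W :+ σY) := X :* X :* (Z :- W))
           refl x (σ * ψ (suc j)) (χ (2 ℕ.+ j)) (χ j) ⟩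
    x * x * (χ (2 ℕ.+ j) - χ j)                                     ∎
    where
    σ = (- 1#) ^ j
    σ′ = (- 1#) ^ suc j
    σ″ = (- 1#) ^ suc (suc j)

  χ-even : Recurrent (λ m → χ (double m))
  χ-even m = χ-recurrence (double m)

  χ-odd : Recurrent (λ m → χ (3 ℕ.+ double m))
  χ-odd m = χ-recurrence (3 ℕ.+ double m)

  χ₁ : χ 1 ≈ x - 1#
  χ₁ = trans (det-singleton (charMatrix 1)) (+-congʳ (*-identityʳ x))

  ψ₁ : ψ 1 ≈ - 1#
  ψ₁ = trans (det-singleton (ψMatrix 1)) (solve 1 (λ X → X :* con (+ 0) :- con (+ 1) := :- con (+ 1)) refl x)

  χ₂ : χ 2 ≈ x * x - 1#
  χ₂ = begin
    χ 2                          ≈⟨ χ-suc² 0 ⟩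
    x * x * 1# + 1# * ψ 1        ≈⟨ +-congˡ (*-congˡ ψ₁) ⟩
    x * x * 1# + 1# * - 1#       ≈⟨ solve 1 (λ X → X :* X :* con (+ 1) :+ con (+ 1) :* :- con (+ 1) := X :* X :- con (+ 1)) refl x ⟩
    x * x - 1#                   ∎

  χ₃ : χ 3 ≈ x * x * (x - 1#) - x
  χ₃ = begin
    χ 3                                      ≈⟨ χ-suc² 1 ⟩
    x * x * χ 1 + - 1# * 1# * ψ 2            ≈⟨ +-cong (*-congˡ χ₁) (*-congˡ (ψ-suc² 0)) ⟩
    x * x * (x - 1#) + - 1# * 1# * (1# + 1# * χ 1)   ≈⟨ +-congˡ (*-congˡ (+-congˡ (*-congˡ χ₁))) ⟩
    x * x * (x - 1#) + - 1# * 1# * (1# + 1# * (x - 1#))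
      ≈⟨ solve 1 (λ X → X :* X :* (X :- con (+ 1)) :+ :- con (+ 1) :* con (+ 1) :* (con (+ 1) :+ con (+ 1) :* (X :- con (+ 1)))
                      := X :* X :* (X :- con (+ 1)) :- X) refl x ⟩
    x * x * (x - 1#) - x                     ∎

  χ-odd≈ : ∀ m → χ (3 ℕ.+ double m) ≈ x * χ (2 ℕ.+ double m) - x * x * χ (double m)
  χ-odd≈ = recurrent-unique χ-odd (recurrent-combination x (x * x) χ-even) χ₃≈ χ₅≈
    where
    χ₃≈ : χ 3 ≈ x * χ 2 - x * x * χ 0
    χ₃≈ = begin
      χ 3                            ≈⟨ χ₃ ⟩
      x * x * (x - 1#) - x
        ≈⟨ solve 1 (λ X → X :* X :* (X :- con (+ 1)) :- X := X :* (X :* X :- con (+ 1)) :- X :* X :* con (+ 1)) refl x ⟩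
      x * (x * x - 1#) - x * x * 1#  ≈⟨ +-congʳ (*-congˡ χ₂) ⟨
      x * χ 2 - x * x * χ 0          ∎
    χ₅≈ : χ 5 ≈ x * χ 4 - x * x * χ 2
    χ₅≈ = begin
      χ 5                                              ≈⟨ χ-recurrence 1 ⟩
      x * x * (χ 3 - χ 1)                              ≈⟨ *-congˡ (+-cong χ₃ (-‿cong χ₁)) ⟩
      x * x * ((x * x * (x - 1#) - x) - (x - 1#))
        ≈⟨ solve 1 (λ X → X :* X :* ((X :* X :* (X :- con (+ 1)) :- X) :- (X :- con (+ 1)))
                        := X :* (X :* X :* ((X :* X :- con (+ 1)) :- con (+ 1))) :- X :* X :* (X :* X :- con (+ 1))) refl x ⟩
      x * (x * x * ((x * x - 1#) - 1#)) - x * x * (x * x - 1#)   ≈⟨ +-cong (*-congˡ (*-congˡ (+-congʳ χ₂))) (-‿cong (*-congˡ χ₂)) ⟨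
      x * (x * x * (χ 2 - χ 0)) - x * x * χ 2          ≈⟨ +-congʳ (*-congˡ (χ-recurrence 0)) ⟨
      x * χ 4 - x * x * χ 2                            ∎

module ClosedForm {c ℓ : Level} (R : CommutativeRing c ℓ) (x : CommutativeRing.Carrier R) where
  open CommutativeRing R
  open RawSemiring (Semiring.rawSemiring semiring) using (_^_; _×_)
  open import Algebra.Properties.Monoid.Mult +-monoid using (×-homo-+)
  open import Relation.Binary.Reasoning.Setoid setoid
  open IntegerCoefficients R
  open RangeSum R
  open Recurrence R x

  -- The paper's even-case summand for n = 2m, with k = j + 1.
  evenTerm : ℕ → ℕ → Carrier
  evenTerm m j = (- 1#) ^ j * (((suc m ∸ j) C j) × 1# * x ^ double (m ∸ j))

  closedForm : ℕ → Carrier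
  closedForm m = sumℕ (suc m) (evenTerm m)

  binomial-zero : ∀ {a k} → a < k → (a C k) × 1# ≈ 0#
  binomial-zero a<k = reflexive (≡.cong (_× 1#) (k>n⇒nCk≡0 a<k))

  pascal : ∀ a k → (suc a C suc k) × 1# ≈ (a C k) × 1# + (a C suc k) × 1#
  pascal a k = trans (reflexive (≡.cong (_× 1#) (≡.sym (nCk+nC[k+1]≡[n+1]C[k+1] a k)))) (×-homo-+ 1# (a C k) (a C suc k))

  term-vanishes : ∀ σ {b} p → b ≈ 0# → σ * (b * p) ≈ 0#
  term-vanishes σ p b≈0 = trans (*-congˡ (trans (*-congʳ b≈0) (zeroˡ p))) (zeroʳ σ)

  evenTerm-vanishes : ∀ m j → suc m < j ℕ.+ j → evenTerm m j ≈ 0#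
  evenTerm-vanishes m (suc j) 1+m<2j =
    term-vanishes _ _ (binomial-zero (ℕ.m<n+o⇒m∸n<o (suc m) (suc j) 1+m<2j))

  closedForm-recurrent : Recurrent closedForm
  closedForm-recurrent m = begin
    sumℕ (3 ℕ.+ m) t                                              ≈⟨ sumℕ-suc (2 ℕ.+ m) t ⟩
    sumℕ (2 ℕ.+ m) t + t (2 ℕ.+ m)                                ≈⟨ +-congˡ (evenTerm-vanishes (2 ℕ.+ m) (2 ℕ.+ m) (s≤s (s≤s (ℕ.m≤n+m (2 ℕ.+ m) m)))) ⟩
    sumℕ (2 ℕ.+ m) t + 0#                                         ≈⟨ +-identityʳ _ ⟩
    t 0 + sumℕ (suc m) (λ j → t (suc j))                          ≈⟨ +-cong t₀ (sumℕ-cong (suc m) pascal-step) ⟩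
    x * x * e₁ 0 + sumℕ (suc m) (λ j → x * x * e₁ (suc j) + - (x * x) * e₀ j)
      ≈⟨ +-congˡ (trans (sumℕ-+ (suc m) (λ j → x * x * e₁ (suc j)) (λ j → - (x * x) * e₀ j))
                        (+-cong (sumℕ-*ˡ (suc m) (x * x) (λ j → e₁ (suc j))) (sumℕ-*ˡ (suc m) (- (x * x)) e₀))) ⟩
    x * x * e₁ 0 + (x * x * sumℕ (suc m) (λ j → e₁ (suc j)) + - (x * x) * closedForm m)
      ≈⟨ solve 4 (λ X a b c → X :* X :* a :+ (X :* X :* b :+ :- (X :* X) :* c) := X :* X :* ((a :+ b) :- c))
           refl x (e₁ 0) (sumℕ (suc m) (λ j → e₁ (suc j))) (closedForm m) ⟩
    x * x * (closedForm (suc m) - closedForm m)                   ∎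
    where
    t = evenTerm (2 ℕ.+ m)
    e₁ = evenTerm (suc m)
    e₀ = evenTerm m
    t₀ : t 0 ≈ x * x * e₁ 0
    t₀ = solve 2 (λ X p → con (+ 1) :* ((con (+ 1) :+ con (+ 0)) :* (X :* (X :* p)))
                        := X :* X :* (con (+ 1) :* ((con (+ 1) :+ con (+ 0)) :* p))) refl x (x ^ double (suc m))
    pascal-step : ∀ j → j < suc m → t (suc j) ≈ x * x * e₁ (suc j) + - (x * x) * e₀ j
    pascal-step j (s≤s j≤m) = begin
      σ′ * (((suc (suc m) ∸ j) C suc j) × 1# * x ^ double (suc m ∸ j))
        ≡⟨ ≡.cong₂ (λ a b → σ′ * ((a C suc j) × 1# * x ^ double b)) (ℕ.+-∸-assoc 1 (ℕ.m≤n⇒m≤1+n j≤m)) (ℕ.+-∸-assoc 1 j≤m) ⟩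
      σ′ * ((suc a C suc j) × 1# * (x * (x * p)))
        ≈⟨ *-congˡ (*-congʳ (pascal a j)) ⟩
      σ′ * (((a C j) × 1# + (a C suc j) × 1#) * (x * (x * p)))
        ≈⟨ solve 5 (λ X σ U V P → (:- con (+ 1) :* σ) :* ((U :+ V) :* (X :* (X :* P)))
                               := X :* X :* ((:- con (+ 1) :* σ) :* (V :* P)) :+ :- (X :* X) :* (σ :* (U :* P)))
             refl x ((- 1#) ^ j) ((a C j) × 1#) ((a C suc j) × 1#) p ⟩
      x * x * e₁ (suc j) + - (x * x) * e₀ j                     ∎
      where
      σ′ = (- 1#) ^ suc j
      a = suc m ∸ j
      p = x ^ double (m ∸ j)

  closedForm₀ : closedForm 0 ≈ 1#
  closedForm₀ = solve 0 (con (+ 1) :* ((con (+ 1) :+ con (+ 0)) :* con (+ 1)) :+ con (+ 0) := con (+ 1)) refl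

  closedForm₁ : closedForm 1 ≈ x * x - 1#
  closedForm₁ = solve 1 (λ X → con (+ 1) :* ((con (+ 1) :+ con (+ 0)) :* (X :* (X :* con (+ 1))))
                             :+ ((:- con (+ 1) :* con (+ 1)) :* ((con (+ 1) :+ con (+ 0)) :* con (+ 1)) :+ con (+ 0))
                             := X :* X :- con (+ 1)) refl x

  rhsEven≈closedForm : ∀ m → rhsEven R (double m) x ≈ closedForm m
  rhsEven≈closedForm m = begin
    rhsEven R (double m) x            ≈⟨ Σ1≈sumℕ L F ⟩
    sumℕ L (λ j → F (suc j))          ≈⟨ sumℕ-cong L (λ j _ → reflexive (≡.cong₂ (λ a e → (- 1#) ^ j * ((a C j) × 1# * x ^ e)) (top≡ j) (exponent≡ j))) ⟩
    sumℕ L (evenTerm m)               ≈⟨ sumℕ-limits L (suc m) (evenTerm m) vanish ⟩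
    closedForm m                      ∎
    where
    L = suc ((double m ℕ.+ 2) / 4)
    F : ℕ → Carrier
    F k = (- 1#) ^ (k ∸ 1) * ((binomℤ ((⌊ double m /2⌋ ℕ.+ 2) ∸ k) (+ k ℤ.- + 1) × 1#) * x ^ ((double m ℕ.+ 2) ∸ 2 ℕ.* k))
    top≡ : ∀ j → (⌊ double m /2⌋ ℕ.+ 2) ∸ suc j ≡ suc m ∸ j
    top≡ j = ≡.cong (_∸ suc j) (≡.trans (≡.cong (ℕ._+ 2) (⌊double/2⌋≡ m)) (ℕ.+-comm m 2))
    exponent≡ : ∀ j → (double m ℕ.+ 2) ∸ 2 ℕ.* suc j ≡ double (m ∸ j)
    exponent≡ j = ≡.trans (≡.cong₂ _∸_ (ℕ.+-comm (double m) 2) (2*≡double (suc j))) (double-∸ m j)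
    vanish : ∀ j → L ≤ j ⊎ suc m ≤ j → evenTerm m j ≈ 0#
    vanish j (inj₁ L≤j)   = evenTerm-vanishes m j (quarter-bound m _ j (ℕ.≤-reflexive (ℕ.+-comm 2 (double m))) L≤j)
    vanish j (inj₂ 1+m≤j) = evenTerm-vanishes m j (1+m≤n⇒1+m<n+n 1+m≤j)

  rhsOdd≈closedForm : ∀ m → rhsOdd R (3 ℕ.+ double m) x ≈ x * closedForm (suc m) - x * x * closedForm m
  rhsOdd≈closedForm m = begin
    rhsOdd R n x                                            ≈⟨ Σ1≈sumℕ L F ⟩
    sumℕ L (λ j → F (suc j))                                ≈⟨ sumℕ-limits L (2 ℕ.+ m) (λ j → F (suc j)) vanish ⟩
    sumℕ (2 ℕ.+ m) (λ j → F (suc j))                        ≈⟨ sumℕ-cong (2 ℕ.+ m) split ⟩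
    sumℕ (2 ℕ.+ m) (λ j → x * e₁ j + shifted j)             ≈⟨ sumℕ-+ (2 ℕ.+ m) (λ j → x * e₁ j) shifted ⟩
    sumℕ (2 ℕ.+ m) (λ j → x * e₁ j) + (0# + sumℕ (suc m) (λ i → - (x * x) * e₀ i))
      ≈⟨ +-cong (sumℕ-*ˡ (2 ℕ.+ m) x e₁) (trans (+-identityˡ _) (sumℕ-*ˡ (suc m) (- (x * x)) e₀)) ⟩
    x * closedForm (suc m) + - (x * x) * closedForm m
      ≈⟨ solve 3 (λ X a b → X :* a :+ :- (X :* X) :* b := X :* a :- X :* X :* b) refl x (closedForm (suc m)) (closedForm m) ⟩
    x * closedForm (suc m) - x * x * closedForm m           ∎
    where
    n = 3 ℕ.+ double m
    L = suc (suc ((n ℕ.+ 2) / 4))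
    F : ℕ → Carrier
    F k = (- 1#) ^ (k ∸ 1) *
      ( (binomℤ (⌊ n ℕ.+ 3 /2⌋ ∸ k) (+ k ℤ.- + 1) × 1#) * x ^ ((n ℕ.+ 2) ∸ 2 ℕ.* k)
      + (binomℤ (⌊ n ℕ.+ 3 /2⌋ ∸ k) (+ k ℤ.- + 2) × 1#) * x ^ ((n ℕ.+ 3) ∸ 2 ℕ.* k))
    e₁ = evenTerm (suc m)
    e₀ = evenTerm m
    shifted : ℕ → Carrier
    shifted zero    = 0#
    shifted (suc i) = - (x * x) * e₀ i
    half≡ : ⌊ n ℕ.+ 3 /2⌋ ≡ 3 ℕ.+ m
    half≡ = ≡.trans (≡.cong ⌊_/2⌋ (ℕ.+-comm n 3)) (⌊double/2⌋≡ (3 ℕ.+ m))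
    coefficient-vanishes : ∀ i k → suc m ∸ i < k → ((⌊ n ℕ.+ 3 /2⌋ ∸ suc (suc i)) C k) × 1# ≈ 0#
    coefficient-vanishes i k lt = trans (reflexive (≡.cong (λ a → ((a ∸ suc (suc i)) C k) × 1#) half≡)) (binomial-zero lt)
    beyond-limits : ∀ i → L ≤ suc i ⊎ 2 ℕ.+ m ≤ suc i → suc m < i ℕ.+ i
    beyond-limits i (inj₁ (s≤s L≤i))   = quarter-bound m (n ℕ.+ 2) i (ℕ.≤-trans (ℕ.n≤1+n _) (ℕ.m≤m+n n 2)) L≤i
    beyond-limits i (inj₂ (s≤s 1+m≤i)) = 1+m≤n⇒1+m<n+n 1+m≤i
    vanish : ∀ j → L ≤ j ⊎ 2 ℕ.+ m ≤ j → F (suc j) ≈ 0#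
    vanish zero    (inj₁ ())
    vanish zero    (inj₂ ())
    vanish (suc zero)    beyond = contradiction (beyond-limits 0 beyond) ℕ.n≮0
    vanish (suc (suc i)) beyond = begin
      F (suc (suc (suc i)))                ≈⟨ *-congˡ (+-cong (*-congʳ (coefficient-vanishes (suc i) (suc (suc i)) (ℕ.m<n⇒m<1+n top<i)))
                                                              (*-congʳ (coefficient-vanishes (suc i) (suc i) top<i))) ⟩
      σ * (0# * p₁ + 0# * p₂)             ≈⟨ solve 3 (λ S P Q → S :* (con (+ 0) :* P :+ con (+ 0) :* Q) := con (+ 0)) refl σ p₁ p₂ ⟩
      0#                                   ∎
      where
      σ = (- 1#) ^ suc (suc i)
      p₁ = x ^ ((n ℕ.+ 2) ∸ 2 ℕ.* suc (suc (suc i)))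
      p₂ = x ^ ((n ℕ.+ 3) ∸ 2 ℕ.* suc (suc (suc i)))
      top<i : suc m ∸ suc i < suc i
      top<i = ℕ.m<n+o⇒m∸n<o (suc m) (suc i) (beyond-limits (suc i) beyond)
    first≡ : ∀ j → j ≤ suc m →
      (binomℤ (⌊ n ℕ.+ 3 /2⌋ ∸ suc j) (+ suc j ℤ.- + 1) × 1#) * x ^ ((n ℕ.+ 2) ∸ 2 ℕ.* suc j)
        ≡ ((suc (suc m) ∸ j) C j) × 1# * (x * x ^ double (suc m ∸ j))
    first≡ j j≤1+m = ≡.cong₂ (λ a e → ((a ∸ suc j) C j) × 1# * x ^ e) half≡
      (≡.trans (≡.cong₂ _∸_ (ℕ.+-comm n 2) (2*≡double (suc j))) (suc-double-∸ (suc m) j j≤1+m))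
    second≡ : ∀ i → i ≤ m →
      (binomℤ (⌊ n ℕ.+ 3 /2⌋ ∸ suc (suc i)) (+ suc (suc i) ℤ.- + 2) × 1#) * x ^ ((n ℕ.+ 3) ∸ 2 ℕ.* suc (suc i))
        ≡ ((suc m ∸ i) C i) × 1# * (x * (x * x ^ double (m ∸ i)))
    second≡ i i≤m = ≡.cong₂ (λ a e → ((a ∸ suc (suc i)) C i) × 1# * x ^ e) half≡
      (≡.trans (≡.cong₂ _∸_ (ℕ.+-comm n 3) (2*≡double (suc (suc i))))
        (≡.trans (double-∸ (3 ℕ.+ m) (suc (suc i))) (≡.cong double (ℕ.+-∸-assoc 1 i≤m))))
    split : ∀ j → j < 2 ℕ.+ m → F (suc j) ≈ x * e₁ j + shifted j
    split zero    _            = begin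
      F 1                                                           ≡⟨ ≡.cong (λ t → 1# * (t + 0# * x ^ ((n ℕ.+ 3) ∸ 2))) (first≡ 0 z≤n) ⟩
      1# * (b × 1# * (x * x ^ double (suc m)) + 0# * x ^ ((n ℕ.+ 3) ∸ 2))
        ≈⟨ solve 4 (λ X C P Q → con (+ 1) :* (C :* (X :* P) :+ con (+ 0) :* Q) := X :* (con (+ 1) :* (C :* P)) :+ con (+ 0))
             refl x (b × 1#) (x ^ double (suc m)) (x ^ ((n ℕ.+ 3) ∸ 2)) ⟩
      x * e₁ 0 + 0#                                                 ∎
      where b = suc (suc m) C 0
    split (suc i) (s≤s (s≤s i≤m)) = begin
      F (suc (suc i))                                               ≡⟨ ≡.cong₂ (λ a b → σ′ * (a + b)) (first≡ (suc i) (s≤s i≤m)) (second≡ i i≤m) ⟩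
      σ′ * (c₁ * (x * p₁) + c₀ * (x * (x * p₀)))
        ≈⟨ solve 6 (λ X S C₁ P₁ C₀ P₀ → (:- con (+ 1) :* S) :* (C₁ :* (X :* P₁) :+ C₀ :* (X :* (X :* P₀)))
                                     := X :* ((:- con (+ 1) :* S) :* (C₁ :* P₁)) :+ :- (X :* X) :* (S :* (C₀ :* P₀)))
             refl x ((- 1#) ^ i) c₁ p₁ c₀ p₀ ⟩
      x * e₁ (suc i) + shifted (suc i)                              ∎
      where
      σ′ = (- 1#) ^ suc i
      c₁ = ((suc m ∸ i) C suc i) × 1#
      p₁ = x ^ double (m ∸ i)
      c₀ = ((suc m ∸ i) C i) × 1#
      p₀ = x ^ double (m ∸ i)

module _ {c ℓ : Level} (R : CommutativeRing c ℓ) (x : CommutativeRing.Carrier R) where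
  open CommutativeRing R
  open import Relation.Binary.Reasoning.Setoid setoid
  open Recurrence R x
  open CharacteristicPolynomial R x
  open ClosedForm R x

  χ≈closedForm : ∀ m → χ (double m) ≈ closedForm m
  χ≈closedForm = recurrent-unique χ-even closedForm-recurrent (sym closedForm₀) (trans χ₂ (sym closedForm₁))

  charPoly-even : ∀ m → charPoly R (double m) x ≈ rhsEven R (double m) x
  charPoly-even m = begin
    charPoly R (double m) x   ≈⟨ charPoly≈χ (double m) ⟩
    χ (double m)              ≈⟨ χ≈closedForm m ⟩
    closedForm m              ≈⟨ rhsEven≈closedForm m ⟨
    rhsEven R (double m) x    ∎

  charPoly-odd : ∀ m → charPoly R (3 ℕ.+ double m) x ≈ rhsOdd R (3 ℕ.+ double m) x
  charPoly-odd m = begin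
    charPoly R (3 ℕ.+ double m) x                         ≈⟨ charPoly≈χ (3 ℕ.+ double m) ⟩
    χ (3 ℕ.+ double m)                                    ≈⟨ χ-odd≈ m ⟩
    x * χ (2 ℕ.+ double m) - x * x * χ (double m)         ≈⟨ +-cong (*-congˡ (χ≈closedForm (suc m))) (-‿cong (*-congˡ (χ≈closedForm m))) ⟩
    x * closedForm (suc m) - x * x * closedForm m         ≈⟨ rhsOdd≈closedForm m ⟨
    rhsOdd R (3 ℕ.+ double m) x                           ∎

open import Data.Product using (_×_)

lemma2p2 : {c ℓ : Level} (R : CommutativeRing c ℓ) (n : ℕ) → n ≥ 2 → (x : CommutativeRing.Carrier R) →
    (2 ∣ n → CommutativeRing._≈_ R (charPoly R n x) (rhsEven R n x))
    × (¬ (2 ∣ n) → CommutativeRing._≈_ R (charPoly R n x) (rhsOdd R n x))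
lemma2p2 R n n≥2 x with even-or-odd n
... | inj₁ (m , ≡.refl)     = (λ _ → charPoly-even R x m) , (λ 2∤n → contradiction (2∣double m) 2∤n)
... | inj₂ (zero , ≡.refl)  = contradiction n≥2 λ { (s≤s ()) }
... | inj₂ (suc m , ≡.refl) = (λ 2∣n → contradiction 2∣n (2∤suc-double (suc m))) , (λ _ → charPoly-odd R x m)
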